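{- Let $\Gamma$ be a cc0-language that is not weakly separable. Then there is a counterexample $(R,\mathbf t_1,\mathbf t_2)$ which is either (1) a union counterexample in which $\mathbf t_1$ is contained in the component generated by some value $a_1$ and $\mathbf t_2$ is contained in the component generated by some value $a_2$, or (2) a difference counterexample in which both $\mathbf t_1$ and $\mathbf t_2$ are contained in the component generated by some value $a_1$.
   Context: $D$ is finite with distinguished $0$; $\Gamma$ is a finite set of relations on $D$. $\Gamma$ is a cc0-language if all its relations contain the all-zero tuple and every relation containing the all-zero tuple obtained from a relation of $\Gamma$ by substituting constants for some coordinates (fixing and deleting them) belongs to $\Gamma$. Tuples are disjoint if at each coordinate at least one entry is $0$; the union $\mathbf t_1+\mathbf t_2$ takes the nonzero entry at each coordinate. A 0-valid relation $R$ is weakly separable if for all disjoint $\mathbf t_1,\mathbf t_2$: $\mathbf t_1,\mathbf t_2\in R\Rightarrow\mathbf t_1+\mathbf t_2\in R$, and $\mathbf t_2,\mathbf t_1+\mathbf t_2\in R\Rightarrow\mathbf t_1\in R$; $\Gamma$ is weakly separable if all its relations are. A union counterexample is $(R,\mathbf t_1,\mathbf t_2)$ with $R\in\Gamma$, disjoint $\mathbf t_1,\mathbf t_2\in R$ and $\mathbf t_1+\mathbf t_2\notin R$; a difference counterexample is $(R,\mathbf t_1,\mathbf t_2)$ with $R\in\Gamma$, disjoint $\mathbf t_1,\mathbf t_2$, $\mathbf t_2,\mathbf t_1+\mathbf t_2\in R$ and $\mathbf t_1\notin R$. For $X\subseteq D\setminus\{0\}$, $\mathrm{pr}_X$ fixes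 $X$ and sends all other values to $0$; nonempty $C\subseteq D\setminus\{0\}$ is a component if applying $\mathrm{pr}_C$ coordinatewise maps every tuple of every $R\in\Gamma$ into $R$; the component generated by a nonzero value $a$ is the inclusion-minimal component containing $a$. A tuple is contained in $C$ if all its nonzero entries lie in $C$. -}

module Defs where

open import Data.Nat using (ℕ; zero; suc)
open import Data.Fin using (Fin; zero; suc)
open import Data.Vec using (Vec; []; _∷_; lookup; replicate; zipWith; map)
open import Data.Maybe using (Maybe; just; nothing)
open import Data.Bool using (Bool; true; false; if_then_else_)
open import Data.Product using (Σ; ∃; _×_; _,_)
open import Data.Sum using (_⊎_)
open import Data.List using (List)
open import Data.List.Membership.Propositional using (_∈_)
open import Data.List.Relation.Unary.All using (All)
open import Relation.Binary.PropositionalEquality using (_≡_; subst)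

-- The domain D = Fin (suc d); the distinguished value 0 is Fin.zero.
Dom : ℕ → Set
Dom d = Fin (suc d)

Rel : ℕ → Set
Rel d = Σ ℕ λ n → Vec (Dom d) n → Bool

arity : ∀ {d} → Rel d → ℕ
arity (n , _) = n

MemR : ∀ {d} (R : Rel d) → Vec (Dom d) (arity R) → Set
MemR (n , P) t = P t ≡ true

infix 4 _∈ᵣ_
_∈ᵣ_ : ∀ {d n} → Vec (Dom d) n → (Vec (Dom d) n → Bool) → Set
t ∈ᵣ P = P t ≡ true

Lang : ℕ → Set
Lang d = List (Rel d)

_≐_ : ∀ {d} → Rel d → Rel d → Set
_≐_ {d} (m , P) (n , Q) = Σ (n ≡ m) λ e → ∀ (t : Vec (Dom d) n) → Q t ≡ P (subst (Vec (Dom d)) e t)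

_∈Γ_ : ∀ {d} → Rel d → Lang d → Set
R ∈Γ Γ = ∃ λ S → S ∈ Γ × (R ≐ S)

zeros : ∀ {d} n → Vec (Dom d) n
zeros n = replicate n zero

ZeroValid : ∀ {d} → Rel d → Set
ZeroValid (n , P) = zeros n ∈ᵣ P

-- Substituting constants: a pattern gives a constant (just c) or keeps the
-- coordinate (nothing). The kept coordinates are the arity of the result.
holes : ∀ {d n} → Vec (Maybe (Dom d)) n → ℕ
holes [] = zero
holes (just _ ∷ p) = holes p
holes (nothing ∷ p) = suc (holes p)

fill : ∀ {d n} (p : Vec (Maybe (Dom d)) n) → Vec (Dom d) (holes p) → Vec (Dom d) n
fill [] t = []
fill (just c ∷ p) t = c ∷ fill p t
fill (nothing ∷ p) (x ∷ t) = x ∷ fill p t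

substConst : ∀ {d} (R : Rel d) → Vec (Maybe (Dom d)) (arity R) → Rel d
substConst (n , P) p = (holes p , λ t → P (fill p t))

IsCC0 : ∀ {d} → Lang d → Set
IsCC0 Γ = All ZeroValid Γ
        × (∀ R → R ∈ Γ → ∀ (p : Vec (Maybe _) (arity R)) →
             ZeroValid (substConst R p) → substConst R p ∈Γ Γ)

Disjoint : ∀ {d n} → Vec (Dom d) n → Vec (Dom d) n → Set
Disjoint t₁ t₂ = ∀ i → lookup t₁ i ≡ zero ⊎ lookup t₂ i ≡ zero

pick : ∀ {d} → Dom d → Dom d → Dom d
pick zero b = b
pick (suc a) b = suc a

_⊕_ : ∀ {d n} → Vec (Dom d) n → Vec (Dom d) n → Vec (Dom d) n
t₁ ⊕ t₂ = zipWith pick t₁ t₂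

WeaklySeparable : ∀ {d} → Rel d → Set
WeaklySeparable {d} (n , P) =
  ∀ (t₁ t₂ : Vec (Dom d) n) → Disjoint t₁ t₂ →
    ((t₁ ∈ᵣ P → t₂ ∈ᵣ P → (t₁ ⊕ t₂) ∈ᵣ P)
     × (t₂ ∈ᵣ P → (t₁ ⊕ t₂) ∈ᵣ P → t₁ ∈ᵣ P))

LangWeaklySeparable : ∀ {d} → Lang d → Set
LangWeaklySeparable Γ = All WeaklySeparable Γ

UnionCounterexample : ∀ {d} → Lang d → (R : Rel d) → Vec (Dom d) (arity R) → Vec (Dom d) (arity R) → Set
UnionCounterexample Γ (n , P) t₁ t₂ =
  (n , P) ∈ Γ × Disjoint t₁ t₂ × t₁ ∈ᵣ P × t₂ ∈ᵣ P × (P (t₁ ⊕ t₂) ≡ false)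

DifferenceCounterexample : ∀ {d} → Lang d → (R : Rel d) → Vec (Dom d) (arity R) → Vec (Dom d) (arity R) → Set
DifferenceCounterexample Γ (n , P) t₁ t₂ =
  (n , P) ∈ Γ × Disjoint t₁ t₂ × t₂ ∈ᵣ P × (t₁ ⊕ t₂) ∈ᵣ P × (P t₁ ≡ false)

-- subsets of D ∖ {0} as characteristic functions (with 0 ↦ false)
SubsetNZ : ℕ → Set
SubsetNZ d = Dom d → Bool

pr : ∀ {d} → SubsetNZ d → Dom d → Dom d
pr X zero = zero
pr X (suc a) = if X (suc a) then suc a else zero

IsComponent : ∀ {d} → Lang d → SubsetNZ d → Set
IsComponent {d} Γ C =
  C zero ≡ false
  × (∃ λ a → C a ≡ true)
  × (∀ R → R ∈ Γ → ∀ (t : Vec (Dom d) (arity R)) →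
       MemR R t → MemR R (map (pr C) t))

GeneratedComponent : ∀ {d} → Lang d → Dom d → SubsetNZ d → Set
GeneratedComponent Γ a C =
  IsComponent Γ C × C a ≡ true
  × (∀ C' → IsComponent Γ C' → C' a ≡ true → ∀ b → C b ≡ true → C' b ≡ true)

ContainedIn : ∀ {d n} → Vec (Dom d) n → SubsetNZ d → Set
ContainedIn t C = ∀ i → lookup t i ≡ zero ⊎ C (lookup t i) ≡ true

InGeneratedComponent : ∀ {d n} → Lang d → Vec (Dom d) n → Dom d → Set
InGeneratedComponent Γ t a = ∃ λ C → GeneratedComponent Γ a C × ContainedIn t C

module Submission where

open import Defs
open import Data.Nat using (ℕ; zero; suc; _+_; _<_; s≤s; z≤n)
open import Data.Product using (Σ; ∃; ∃₂; _×_; _,_)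
open import Data.Sum using (_⊎_; inj₁; inj₂; swap)
open import Data.Vec using (Vec; []; _∷_; lookup; map; tabulate)
open import Relation.Nullary using (¬_; Dec; yes; no)

open import Data.Nat.Properties using (+-suc; +-comm; m<m+n; m<n+m; +-monoˡ-<)
open import Data.Nat.Induction using (<-wellFounded)
open import Induction.WellFounded using (Acc; acc)
open import Data.Fin using (Fin; zero; suc)
open import Data.Fin.Properties using (any?; all?) renaming (_≟_ to _≟ᶠ_)
open import Data.Vec.Properties
  using (lookup-map; lookup-replicate; lookup∘tabulate; map-cong; map-∘; map-id)
open import Data.Vec.Relation.Binary.Pointwise.Inductive as Pointwise using (Pointwise; []; _∷_)
open import Data.Vec.Relation.Binary.Pointwise.Extensional using (ext; extensional⇒inductive)
open import Data.Maybe using (Maybe; just; nothing)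
open import Data.Bool using (Bool; true; false; _∧_; if_then_else_)
open import Data.Bool.Properties using (¬-not; ∧-conicalˡ; ∧-conicalʳ; ∧-identityʳ; ∧-zeroʳ)
  renaming (_≟_ to _≟ᵇ_)
open import Data.List using (List; []; _∷_; _++_)
import Data.List as List
open import Data.List.Membership.Propositional using (_∈_; find)
open import Data.List.Membership.Propositional.Properties using (∈-map⁺; ∈-++⁺ˡ; ∈-++⁺ʳ)
open import Data.List.Relation.Unary.Any using (here; there)
import Data.List.Relation.Unary.All as All
open import Data.Empty using (⊥-elim)
open import Relation.Binary.PropositionalEquality
open import Relation.Nullary.Decidable using (map′; _×-dec_; _⊎-dec_; _→-dec_)

-- Measure a counterexample (R, t₁, t₂) by its weight, the total number of nonzero
-- entries of t₁ and t₂.  Starting from any counterexample (found by exhaustive search, since all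
-- relations are finite and decidable) we descend in weight until the counterexample is localized:
--   * A union counterexample all of whose tuples lie in generated components is localized.  Otherwise
--     one tuple, say t₁, is split by the component C generated by one of its values into
--     t₁ = pr_C t₁ ⊕ (rest), both parts nonzero; pr_C t₁ ∈ R, and a four-way case distinction
--     produces a lighter counterexample (lemma splitUnion).
--   * For a difference counterexample let C be generated by a nonzero value of t₁.  If pr_C t₁ ∉ R,
--     projecting both tuples onto C gives a localized difference counterexample.  Otherwise a
--     similar case distinction on t₁ = pr_C t₁ ⊕ (rest) gives a lighter one (lemma splitDifference).
-- Some of the cases pass to the relation obtained by fixing the nonzero entries of a tuple w ∈ R as
-- constants; this is where the cc0 hypothesis enters (lemma section).

private variable
  d m n : ℕ
  Γ : Lang d
  C : SubsetNZ d
  P : Vec (Dom d) n → Bool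
  s t t₁ t₂ u w x y : Vec (Dom d) n

anyTuple? : ∀ {k} n {Q : Vec (Fin k) n → Set} → (∀ t → Dec (Q t)) → Dec (∃ Q)
anyTuple? zero    Q? = map′ ([] ,_) (λ { ([] , q) → q }) (Q? [])
anyTuple? (suc n) Q? = map′ (λ { (x , t , q) → x ∷ t , q }) (λ { (x ∷ t , q) → x , t , q })
  (any? λ x → anyTuple? n (λ t → Q? (x ∷ t)))

allTuples? : ∀ {k} n {Q : Vec (Fin k) n → Set} → (∀ t → Dec (Q t)) → Dec (∀ t → Q t)
allTuples? zero    Q? = map′ (λ { q [] → q }) (λ q → q []) (Q? [])
allTuples? (suc n) Q? = map′ (λ { q (x ∷ t) → q x t }) (λ q x t → q (x ∷ t))
  (all? λ x → allTuples? n (λ t → Q? (x ∷ t)))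

boolVecs : ∀ k → List (Vec Bool k)
boolVecs zero    = [] ∷ []
boolVecs (suc k) = List.map (true ∷_) (boolVecs k) ++ List.map (false ∷_) (boolVecs k)

boolVecs-complete : ∀ {k} (v : Vec Bool k) → v ∈ boolVecs k
boolVecs-complete []          = here refl
boolVecs-complete (true ∷ v)  = ∈-++⁺ˡ (∈-map⁺ (true ∷_) (boolVecs-complete v))
boolVecs-complete (false ∷ v) = ∈-++⁺ʳ _ (∈-map⁺ (false ∷_) (boolVecs-complete v))

_∩_ : ∀ {A : Set} → (A → Bool) → (A → Bool) → A → Bool
(C ∩ C') x = C x ∧ C' x

-- A decidable family of subsets of a finite set which is closed under pointwise equality and
-- under intersection and has a member has a least member: the intersection of all its members.
module LeastMember {k} (Good : (Fin k → Bool) → Set) (good? : ∀ C → Dec (Good C))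
    (good-≗ : ∀ {C C'} → C ≗ C' → Good C → Good C')
    (good-∩ : ∀ {C C'} → Good C → Good C' → Good (C ∩ C')) where

  meet : (Fin k → Bool) → List (Vec Bool k) → Fin k → Bool
  meet C []       = C
  meet C (v ∷ vs) with good? (lookup v)
  ... | yes _ = meet (C ∩ lookup v) vs
  ... | no  _ = meet C vs

  meet-good : ∀ {C} vs → Good C → Good (meet C vs)
  meet-good []       g = g
  meet-good (v ∷ vs) g with good? (lookup v)
  ... | yes g′ = meet-good vs (good-∩ g g′)
  ... | no  _  = meet-good vs g

  meet-⊆ : ∀ {C b} vs → meet C vs b ≡ true → C b ≡ true
  meet-⊆ []       e = e
  meet-⊆ (v ∷ vs) e with good? (lookup v)
  ... | yes _ = ∧-conicalˡ _ _ (meet-⊆ vs e)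
  ... | no  _ = meet-⊆ vs e

  meet-least : ∀ {C v b} vs → v ∈ vs → Good (lookup v) → meet C vs b ≡ true → lookup v b ≡ true
  meet-least (w ∷ vs) (here refl) g e with good? (lookup w)
  ... | yes _  = ∧-conicalʳ _ _ (meet-⊆ vs e)
  ... | no  ¬g = ⊥-elim (¬g g)
  meet-least (w ∷ vs) (there v∈vs) g e with good? (lookup w)
  ... | yes _ = meet-least vs v∈vs g e
  ... | no  _ = meet-least vs v∈vs g e

  least : ∃ Good → Σ (Fin k → Bool) λ C → Good C × (∀ C' → Good C' → ∀ b → C b ≡ true → C' b ≡ true)
  least (C₀ , g₀) = meet C₀ (boolVecs k) , meet-good (boolVecs k) g₀ , below
    where
    below : ∀ C' → Good C' → ∀ b → meet C₀ (boolVecs k) b ≡ true → C' b ≡ true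
    below C' g b e = subst (_≡ true) (lookup∘tabulate C' b)
      (meet-least (boolVecs k) (boolVecs-complete (tabulate C'))
        (good-≗ (λ x → sym (lookup∘tabulate C' x)) g) e)

-- Two values are apart if one of them is 0; tuples are disjoint iff they are apart coordinatewise.
-- Disj is the inductive form of Disjoint, suited to proofs by recursion on tuples.
Apart : Dom d → Dom d → Set
Apart x y = x ≡ zero ⊎ y ≡ zero

Disj : Vec (Dom d) n → Vec (Dom d) n → Set
Disj = Pointwise Apart

toDisj : Disjoint t₁ t₂ → Disj t₁ t₂
toDisj dj = extensional⇒inductive (ext dj)

fromDisj : Disj t₁ t₂ → Disjoint t₁ t₂
fromDisj = Pointwise.lookup

disj-sym : Disj t₁ t₂ → Disj t₂ t₁
disj-sym = Pointwise.sym swap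

differ : ∀ {a b : Bool} → a ≡ true → b ≡ false → a ≢ b
differ refl refl ()

pick-identityʳ : ∀ (x : Dom d) → pick x zero ≡ x
pick-identityʳ zero    = refl
pick-identityʳ (suc x) = refl

pick-comm : ∀ {x y : Dom d} → Apart x y → pick x y ≡ pick y x
pick-comm {x = zero}          _ = sym (pick-identityʳ _)
pick-comm {x = suc x} {zero}  _ = refl
pick-comm {x = suc x} {suc y} (inj₁ ())
pick-comm {x = suc x} {suc y} (inj₂ ())

⊕-identityʳ : ∀ (t : Vec (Dom d) n) → t ⊕ zeros n ≡ t
⊕-identityʳ []      = refl
⊕-identityʳ (x ∷ t) = cong₂ _∷_ (pick-identityʳ x) (⊕-identityʳ t)

⊕-comm : Disj t₁ t₂ → t₁ ⊕ t₂ ≡ t₂ ⊕ t₁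
⊕-comm []        = refl
⊕-comm (xy ∷ dj) = cong₂ _∷_ (pick-comm xy) (⊕-comm dj)

⊕-disj : Disj x w → Disj y w → Disj (x ⊕ y) w
⊕-disj []               []         = []
⊕-disj (inj₁ refl ∷ xw) (yw ∷ yws) = yw ∷ ⊕-disj xw yws
⊕-disj (inj₂ refl ∷ xw) (_ ∷ yws)  = inj₂ refl ∷ ⊕-disj xw yws

nonzeros : Vec (Dom d) n → ℕ
nonzeros []          = 0
nonzeros (zero ∷ t)  = nonzeros t
nonzeros (suc _ ∷ t) = suc (nonzeros t)

nonzeros-⊕ : Disj t₁ t₂ → nonzeros (t₁ ⊕ t₂) ≡ nonzeros t₁ + nonzeros t₂
nonzeros-⊕ []                                     = refl
nonzeros-⊕ {t₁ = zero ∷ _}     {zero ∷ _}  (_ ∷ dj) = nonzeros-⊕ dj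
nonzeros-⊕ {t₁ = zero ∷ t₁}    {suc _ ∷ t₂} (_ ∷ dj) =
  trans (cong suc (nonzeros-⊕ dj)) (sym (+-suc (nonzeros t₁) (nonzeros t₂)))
nonzeros-⊕ {t₁ = suc _ ∷ _}    {zero ∷ _}  (_ ∷ dj) = cong suc (nonzeros-⊕ dj)
nonzeros-⊕ {t₁ = suc _ ∷ _}    {suc _ ∷ _} (inj₁ () ∷ _)
nonzeros-⊕ {t₁ = suc _ ∷ _}    {suc _ ∷ _} (inj₂ () ∷ _)

zeros-or-entry : ∀ (t : Vec (Dom d) n) → t ≡ zeros n ⊎ ∃₂ λ i b → lookup t i ≡ suc b
zeros-or-entry []          = inj₁ refl
zeros-or-entry (suc b ∷ t) = inj₂ (zero , b , refl)
zeros-or-entry (zero ∷ t) with zeros-or-entry t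
... | inj₁ t≡0           = inj₁ (cong (zero ∷_) t≡0)
... | inj₂ (i , b , t[i]) = inj₂ (suc i , b , t[i])

entry⇒positive : ∀ (t : Vec (Dom d) n) i {b} → lookup t i ≡ suc b → 0 < nonzeros t
entry⇒positive (zero ∷ t)  zero    ()
entry⇒positive (suc _ ∷ t) zero    _    = s≤s z≤n
entry⇒positive (zero ∷ t)  (suc i) t[i] = entry⇒positive t i t[i]
entry⇒positive (suc _ ∷ t) (suc i) _    = s≤s z≤n

positive : t ≢ zeros n → 0 < nonzeros t
positive {t = t} t≢0 with zeros-or-entry t
... | inj₁ t≡0            = ⊥-elim (t≢0 t≡0)
... | inj₂ (i , _ , t[i]) = entry⇒positive t i t[i]

summand-nonzero : ∀ (P : Vec (Dom d) n → Bool) {t t'} → P t ≢ P (t ⊕ t') → t' ≢ zeros n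
summand-nonzero P {t} ne t'≡0 = ne (cong P (sym (trans (cong (t ⊕_) t'≡0) (⊕-identityʳ t))))

pick-map : ∀ (f : Dom d → Dom d) → f zero ≡ zero → ∀ {x y} → Apart x y → f (pick x y) ≡ pick (f x) (f y)
pick-map f f0 {y = y} (inj₁ refl) = cong (λ z → pick z (f y)) (sym f0)
pick-map f f0 {x = x} (inj₂ refl) =
  trans (cong f (pick-identityʳ x)) (sym (trans (cong (pick (f x)) f0) (pick-identityʳ (f x))))

map-disj : ∀ (f : Dom d → Dom d) → f zero ≡ zero → Disj t₁ t₂ → Disj (map f t₁) t₂
map-disj f f0 []                 = []
map-disj f f0 (inj₁ refl ∷ dj)   = inj₁ f0 ∷ map-disj f f0 dj
map-disj f f0 (inj₂ x≡0 ∷ dj)    = inj₂ x≡0 ∷ map-disj f f0 dj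

map-⊕ : ∀ (f : Dom d → Dom d) → f zero ≡ zero → Disj t₁ t₂ → map f (t₁ ⊕ t₂) ≡ map f t₁ ⊕ map f t₂
map-⊕ f f0 []        = refl
map-⊕ f f0 (xy ∷ dj) = cong₂ _∷_ (pick-map f f0 xy) (map-⊕ f f0 dj)

prᶜ : SubsetNZ d → Dom d → Dom d
prᶜ C zero    = zero
prᶜ C (suc a) = if C (suc a) then zero else suc a

inside outside : SubsetNZ d → Vec (Dom d) n → Vec (Dom d) n
inside  C = map (pr C)
outside C = map (prᶜ C)

split : ∀ C (t : Vec (Dom d) n) → inside C t ⊕ outside C t ≡ t
split C []      = refl
split C (x ∷ t) = cong₂ _∷_ (pick-pr x) (split C t)
  where
  pick-pr : ∀ x → pick (pr C x) (prᶜ C x) ≡ x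
  pick-pr zero    = refl
  pick-pr (suc a) with C (suc a)
  ... | true  = refl
  ... | false = refl

split-disj : ∀ C (t : Vec (Dom d) n) → Disj (inside C t) (outside C t)
split-disj C []      = []
split-disj C (x ∷ t) = apart x ∷ split-disj C t
  where
  apart : ∀ x → Apart (pr C x) (prᶜ C x)
  apart zero    = inj₁ refl
  apart (suc a) with C (suc a)
  ... | true  = inj₂ refl
  ... | false = inj₁ refl

nonzeros-split : ∀ C (t : Vec (Dom d) n) → nonzeros (inside C t) + nonzeros (outside C t) ≡ nonzeros t
nonzeros-split C t = trans (sym (nonzeros-⊕ (split-disj C t))) (cong nonzeros (split C t))

inside-disj : ∀ C → Disj t₁ t₂ → Disj (inside C t₁) (inside C t₂)
inside-disj C dj = disj-sym (map-disj (pr C) refl (disj-sym (map-disj (pr C) refl dj)))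

inside-contained : ∀ C (t : Vec (Dom d) n) → ContainedIn (inside C t) C
inside-contained C t i rewrite lookup-map i (pr C) t = pr-in (lookup t i)
  where
  pr-in : ∀ x → pr C x ≡ zero ⊎ C (pr C x) ≡ true
  pr-in zero    = inj₁ refl
  pr-in (suc a) with C (suc a) in a∈C
  ... | true  = inj₂ a∈C
  ... | false = inj₁ refl

outside-zeros⇒contained : ∀ C (t : Vec (Dom d) n) → outside C t ≡ zeros n → ContainedIn t C
outside-zeros⇒contained C t out≡0 i =
  prᶜ-zero (lookup t i) (trans (sym (lookup-map i (prᶜ C) t))
                               (trans (cong (λ v → lookup v i) out≡0) (lookup-replicate i zero)))
  where
  prᶜ-zero : ∀ x → prᶜ C x ≡ zero → x ≡ zero ⊎ C x ≡ true
  prᶜ-zero zero    _ = inj₁ refl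
  prᶜ-zero (suc a) e with C (suc a)
  ... | true  = inj₂ refl
  prᶜ-zero (suc a) () | false

inside-positive : ∀ C (t : Vec (Dom d) n) i {b} → lookup t i ≡ suc b → C (suc b) ≡ true →
  0 < nonzeros (inside C t)
inside-positive C t i {b} t[i] b∈C =
  entry⇒positive (inside C t) i
    (trans (lookup-map i (pr C) t) (trans (cong (pr C) t[i]) (cong (λ c → if c then suc b else zero) b∈C)))

fixNonzero : Vec (Dom d) n → Vec (Maybe (Dom d)) n
fixNonzero []          = []
fixNonzero (zero ∷ w)  = nothing ∷ fixNonzero w
fixNonzero (suc a ∷ w) = just (suc a) ∷ fixNonzero w

free : ∀ (w t : Vec (Dom d) n) → Vec (Dom d) (holes (fixNonzero w))
free []          []      = []
free (zero ∷ w)  (x ∷ t) = x ∷ free w t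
free (suc _ ∷ w) (_ ∷ t) = free w t

fill-free : Disj t w → fill (fixNonzero w) (free w t) ≡ t ⊕ w
fill-free []                                         = refl
fill-free {t = x ∷ _}     {zero ∷ _}  (_ ∷ dj)        = cong₂ _∷_ (sym (pick-identityʳ x)) (fill-free dj)
fill-free {t = zero ∷ _}  {suc a ∷ _} (_ ∷ dj)        = cong (suc a ∷_) (fill-free dj)
fill-free {t = suc _ ∷ _} {suc _ ∷ _} (inj₁ () ∷ _)
fill-free {t = suc _ ∷ _} {suc _ ∷ _} (inj₂ () ∷ _)

fill-zeros : ∀ (w : Vec (Dom d) n) → fill (fixNonzero w) (zeros (holes (fixNonzero w))) ≡ w
fill-zeros []          = refl
fill-zeros (zero ∷ w)  = cong (zero ∷_) (fill-zeros w)
fill-zeros (suc a ∷ w) = cong (suc a ∷_) (fill-zeros w)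

free-⊕ : ∀ (w t₁ t₂ : Vec (Dom d) n) → free w (t₁ ⊕ t₂) ≡ free w t₁ ⊕ free w t₂
free-⊕ []          []        []        = refl
free-⊕ (zero ∷ w)  (x ∷ t₁)  (y ∷ t₂)  = cong (pick x y ∷_) (free-⊕ w t₁ t₂)
free-⊕ (suc _ ∷ w) (_ ∷ t₁)  (_ ∷ t₂)  = free-⊕ w t₁ t₂

free-disj : ∀ (w : Vec (Dom d) n) → Disj t₁ t₂ → Disj (free w t₁) (free w t₂)
free-disj []          []        = []
free-disj (zero ∷ w)  (xy ∷ dj) = xy ∷ free-disj w dj
free-disj (suc _ ∷ w) (_ ∷ dj)  = free-disj w dj

nonzeros-free : Disj t w → nonzeros (free w t) ≡ nonzeros t
nonzeros-free []                                         = refl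
nonzeros-free {t = zero ∷ _}  {zero ∷ _}  (_ ∷ dj)       = nonzeros-free dj
nonzeros-free {t = suc _ ∷ _} {zero ∷ _}  (_ ∷ dj)       = cong suc (nonzeros-free dj)
nonzeros-free {t = zero ∷ _}  {suc _ ∷ _} (_ ∷ dj)       = nonzeros-free dj
nonzeros-free {t = suc _ ∷ _} {suc _ ∷ _} (inj₁ () ∷ _)
nonzeros-free {t = suc _ ∷ _} {suc _ ∷ _} (inj₂ () ∷ _)

pr-cong : ∀ {C C' : SubsetNZ d} → C ≗ C' → pr C ≗ pr C'
pr-cong C≗C' zero    = refl
pr-cong C≗C' (suc a) = cong (λ c → if c then suc a else zero) (C≗C' (suc a))

pr-∩ : ∀ (C C' : SubsetNZ d) x → pr (C ∩ C') x ≡ pr C (pr C' x)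
pr-∩ C C' zero    = refl
pr-∩ C C' (suc a) with C' (suc a)
... | true  = cong (λ c → if c then suc a else zero) (∧-identityʳ (C (suc a)))
... | false = cong (λ c → if c then suc a else zero) (∧-zeroʳ (C (suc a)))

project : IsComponent Γ C → (n , P) ∈ Γ → P t ≡ true → P (inside C t) ≡ true
project (_ , _ , closed) R∈Γ = closed _ R∈Γ _

isComponent-≗ : ∀ {C C'} → C ≗ C' → IsComponent Γ C → IsComponent Γ C'
isComponent-≗ C≗C' (0∉C , (a , a∈C) , closed) =
  trans (sym (C≗C' zero)) 0∉C , (a , trans (sym (C≗C' a)) a∈C) ,
  λ R R∈Γ t t∈R → subst (MemR R) (map-cong (pr-cong C≗C') t) (closed R R∈Γ t t∈R)

isComponent-∩ : ∀ {C C' a} → IsComponent Γ C → IsComponent Γ C' → C a ≡ true → C' a ≡ true →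
  IsComponent Γ (C ∩ C')
isComponent-∩ {C = C} {C'} {a} (0∉C , _ , closed) (_ , _ , closed') a∈C a∈C' =
  cong (_∧ C' zero) 0∉C , (a , cong₂ _∧_ a∈C a∈C') ,
  λ R R∈Γ t t∈R → subst (MemR R) (sym (trans (map-cong (pr-∩ C C') t) (map-∘ (pr C) (pr C') t)))
                                 (closed R R∈Γ _ (closed' R R∈Γ t t∈R))

nonzeroValues : SubsetNZ d
nonzeroValues zero    = false
nonzeroValues (suc _) = true

nonzeroValues-component : ∀ {Γ : Lang d} → Fin d → IsComponent Γ nonzeroValues
nonzeroValues-component b =
  refl , (suc b , refl) , λ R _ t t∈R → subst (MemR R) (sym (trans (map-cong pr-id t) (map-id t))) t∈R
  where
  pr-id : ∀ x → pr nonzeroValues x ≡ x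
  pr-id zero    = refl
  pr-id (suc _) = refl

isComponent? : ∀ (Γ : Lang d) C → Dec (IsComponent Γ C)
isComponent? {d} Γ C =
  map′ (λ (0∉C , nonempty , all) → 0∉C , nonempty , λ R R∈Γ → All.lookup all R∈Γ)
       (λ (0∉C , nonempty , closed) → 0∉C , nonempty , All.tabulate λ {R} R∈Γ → closed R R∈Γ)
       ((C zero ≟ᵇ false) ×-dec any? (λ a → C a ≟ᵇ true) ×-dec All.all? preserved? Γ)
  where
  preserved? : ∀ (R : Rel d) → Dec (∀ t → MemR R t → MemR R (map (pr C) t))
  preserved? (n , P) = allTuples? n λ t → (P t ≟ᵇ true) →-dec (P (map (pr C) t) ≟ᵇ true)

generatedComponent : ∀ (Γ : Lang d) (b : Fin d) → Σ (SubsetNZ d) (GeneratedComponent Γ (suc b))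
generatedComponent Γ b =
  let C , (isC , b∈C) , minimal = least (nonzeroValues , nonzeroValues-component b , refl)
  in  C , isC , b∈C , λ C' isC' b∈C' → minimal C' (isC' , b∈C')
  where
  open LeastMember (λ C → IsComponent Γ C × C (suc b) ≡ true)
                   (λ C → isComponent? Γ C ×-dec (C (suc b) ≟ᵇ true))
                   (λ C≗C' (isC , b∈C) → isComponent-≗ C≗C' isC , trans (sym (C≗C' (suc b))) b∈C)
                   (λ (isC , b∈C) (isC' , b∈C') → isComponent-∩ isC isC' b∈C b∈C' , cong₂ _∧_ b∈C b∈C')

record UnionFailure {d n} (P : Vec (Dom d) n → Bool) (t₁ t₂ : Vec (Dom d) n) : Set where
  constructor ∪-failure
  field
    first∈  : P t₁ ≡ true
    second∈ : P t₂ ≡ true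
    union∉  : P (t₁ ⊕ t₂) ≡ false

record DifferenceFailure {d n} (P : Vec (Dom d) n → Bool) (t₁ t₂ : Vec (Dom d) n) : Set where
  constructor ∖-failure
  field
    second∈ : P t₂ ≡ true
    union∈  : P (t₁ ⊕ t₂) ≡ true
    first∉  : P t₁ ≡ false

Failure : (Vec (Dom d) n → Bool) → Vec (Dom d) n → Vec (Dom d) n → Set
Failure P t₁ t₂ = UnionFailure P t₁ t₂ ⊎ DifferenceFailure P t₁ t₂

Violation : Rel d → Set
Violation (n , P) = ∃₂ λ t₁ t₂ → Disjoint t₁ t₂ × Failure P t₁ t₂

Counterexample : Lang d → Set
Counterexample Γ = ∃ λ R → R ∈ Γ × Violation R

weight : Counterexample Γ → ℕ
weight ((_ , _) , _ , t₁ , t₂ , _) = nonzeros t₁ + nonzeros t₂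

Lighter : Lang d → ℕ → Set
Lighter Γ m = Σ (Counterexample Γ) λ c → weight c < m

Localized : ∀ {d} → Lang d → Set
Localized {d} Γ =
  ∃ λ (R : Rel d) → ∃ λ (t₁ : Vec (Dom d) (arity R)) → ∃ λ (t₂ : Vec (Dom d) (arity R)) →
    (UnionCounterexample Γ R t₁ t₂
      × (∃ λ a₁ → ∃ λ a₂ → InGeneratedComponent Γ t₁ a₁ × InGeneratedComponent Γ t₂ a₂))
    ⊎ (DifferenceCounterexample Γ R t₁ t₂
      × (∃ λ a₁ → InGeneratedComponent Γ t₁ a₁ × InGeneratedComponent Γ t₂ a₁))

lighter : (n , P) ∈ Γ → Disj t₁ t₂ → Failure P t₁ t₂ → nonzeros t₁ + nonzeros t₂ < m → Lighter Γ m
lighter R∈Γ dj f lt = (_ , R∈Γ , _ , _ , fromDisj dj , f) , lt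

union-sym : Disj t₁ t₂ → UnionFailure P t₁ t₂ → UnionFailure P t₂ t₁
union-sym {P = P} dj (∪-failure p₁ p₂ p₁₂) = ∪-failure p₂ p₁ (trans (cong P (⊕-comm (disj-sym dj))) p₁₂)

union-nonzero₂ : UnionFailure P t₁ t₂ → t₂ ≢ zeros n
union-nonzero₂ {P = P} (∪-failure p₁ _ p₁₂) = summand-nonzero P (differ p₁ p₁₂)

difference-nonzero₂ : DifferenceFailure P t₁ t₂ → t₂ ≢ zeros n
difference-nonzero₂ {P = P} (∖-failure _ p₁₂ p₁) = summand-nonzero P λ e → differ p₁₂ p₁ (sym e)

failure-transfer : ∀ {k} {Q : Vec (Dom d) k → Bool} {a b} →
  Q a ≡ P x → Q b ≡ P y → Q (a ⊕ b) ≡ P (x ⊕ y) → Failure P x y → Failure Q a b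
failure-transfer ea eb eab (inj₁ (∪-failure px py pxy)) =
  inj₁ (∪-failure (trans ea px) (trans eb py) (trans eab pxy))
failure-transfer ea eb eab (inj₂ (∖-failure py pxy px)) =
  inj₂ (∖-failure (trans eb py) (trans eab pxy) (trans ea px))

zeroValid : IsCC0 Γ → (n , P) ∈ Γ → P (zeros n) ≡ true
zeroValid (allZeroValid , _) R∈Γ = All.lookup allZeroValid R∈Γ

section : ∀ {Γ : Lang d} → IsCC0 Γ → (n , P) ∈ Γ → ∀ w → P w ≡ true →
  Σ (Vec (Dom d) (holes (fixNonzero w)) → Bool) λ Q →
    (_ , Q) ∈ Γ × (∀ {t} → Disj t w → Q (free w t) ≡ P (t ⊕ w))
section {P = P} (_ , closed) R∈Γ w w∈R
  with closed _ R∈Γ (fixNonzero w) (trans (cong P (fill-zeros w)) w∈R)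
... | (_ , Q) , Q∈Γ , refl , Q≡ = Q , Q∈Γ , λ dj → trans (Q≡ _) (cong P (fill-free dj))

viaSection : IsCC0 Γ → (n , P) ∈ Γ → P w ≡ true → Disj x w → Disj y w → Disj x y →
  Failure (λ t → P (t ⊕ w)) x y → nonzeros x + nonzeros y < m → Lighter Γ m
viaSection {w = w} {x = x} {y = y} {m = m} cc0 R∈Γ w∈R xw yw xy f lt =
  let Q , Q∈Γ , Q≡ = section cc0 R∈Γ w w∈R in
  lighter Q∈Γ (free-disj w xy)
    (failure-transfer (Q≡ xw) (Q≡ yw) (trans (cong Q (sym (free-⊕ w x y))) (Q≡ (⊕-disj xw yw))) f)
    (subst₂ (λ a b → a + b < m) (sym (nonzeros-free xw)) (sym (nonzeros-free yw)) lt)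

splitUnion : IsCC0 Γ → (n , P) ∈ Γ → UnionFailure P t₁ t₂ →
  s ⊕ u ≡ t₁ → Disj s u → Disj s t₂ → Disj u t₂ → P s ≡ true → 0 < nonzeros s → 0 < nonzeros u →
  Lighter Γ (nonzeros s + nonzeros u + nonzeros t₂)
splitUnion {P = P} {t₂ = t₂} {s = s} {u = u} cc0 R∈Γ uf@(∪-failure p₁ p₂ p₁₂) s⊕u su st ut s∈R +s +u
  with P (s ⊕ t₂) in e₁ | P (u ⊕ t₂) in e₂ | P u in e₃
... | false | _     | _     =
  lighter R∈Γ st (inj₁ (∪-failure s∈R p₂ e₁)) (+-monoˡ-< (nonzeros t₂) (m<m+n _ +u))
... | true  | true  | _     =
  viaSection cc0 R∈Γ p₂ st ut su (inj₁ (∪-failure e₁ e₂ (trans (cong (λ v → P (v ⊕ t₂)) s⊕u) p₁₂)))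
    (m<m+n _ (positive (union-nonzero₂ uf)))
... | true  | false | true  =
  lighter R∈Γ ut (inj₁ (∪-failure e₃ p₂ e₂)) (+-monoˡ-< (nonzeros t₂) (m<n+m _ +s))
... | true  | false | false =
  lighter R∈Γ (disj-sym su) (inj₂ (∖-failure s∈R (trans (cong P (trans (⊕-comm (disj-sym su)) s⊕u)) p₁) e₃))
    (subst (_< nonzeros s + nonzeros u + nonzeros t₂) (+-comm (nonzeros s) (nonzeros u))
           (m<m+n _ (positive (union-nonzero₂ uf))))

splitDifference : IsCC0 Γ → (n , P) ∈ Γ → DifferenceFailure P t₁ t₂ →
  s ⊕ u ≡ t₁ → Disj s u → Disj s t₂ → Disj u t₂ → P s ≡ true → 0 < nonzeros s →
  Lighter Γ (nonzeros s + nonzeros u + nonzeros t₂)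
splitDifference {P = P} {t₂ = t₂} {s = s} {u = u} cc0 R∈Γ df@(∖-failure p₂ p₁₂ p₁) s⊕u su st ut s∈R +s
  with P u in e₁ | P (u ⊕ t₂) in e₂ | P (s ⊕ t₂) in e₃
... | true  | _     | _     =
  lighter R∈Γ su (inj₁ (∪-failure s∈R e₁ (trans (cong P s⊕u) p₁)))
    (m<m+n _ (positive (difference-nonzero₂ df)))
... | false | true  | _     =
  lighter R∈Γ ut (inj₂ (∖-failure p₂ e₂ e₁)) (+-monoˡ-< (nonzeros t₂) (m<n+m _ +s))
... | false | false | true  =
  viaSection cc0 R∈Γ p₂ ut st (disj-sym su)
    (inj₂ (∖-failure e₃ (trans (cong (λ v → P (v ⊕ t₂)) (trans (⊕-comm (disj-sym su)) s⊕u)) p₁₂) e₂))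
    (subst (_< nonzeros s + nonzeros u + nonzeros t₂) (+-comm (nonzeros s) (nonzeros u))
           (m<m+n _ (positive (difference-nonzero₂ df))))
... | false | false | false =
  lighter R∈Γ st (inj₁ (∪-failure s∈R p₂ e₃)) (+-monoˡ-< (nonzeros t₂) (m<m+n _ +u))
  where
  -- u ≠ 0, as otherwise t₁ = s would lie in R.
  +u : 0 < nonzeros u
  +u = positive (summand-nonzero P λ e → differ s∈R p₁ (trans e (cong P s⊕u)))

unionCounterexample : (n , P) ∈ Γ → Disj t₁ t₂ → UnionFailure P t₁ t₂ →
  UnionCounterexample Γ (n , P) t₁ t₂
unionCounterexample R∈Γ dj (∪-failure p₁ p₂ p₁₂) = R∈Γ , fromDisj dj , p₁ , p₂ , p₁₂

differenceCounterexample : (n , P) ∈ Γ → Disj t₁ t₂ → DifferenceFailure P t₁ t₂ →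
  DifferenceCounterexample Γ (n , P) t₁ t₂
differenceCounterexample R∈Γ dj (∖-failure p₂ p₁₂ p₁) = R∈Γ , fromDisj dj , p₂ , p₁₂ , p₁

localize : ∀ (Γ : Lang d) (t : Vec (Dom d) n) → t ≢ zeros n →
  (∃ λ a → InGeneratedComponent Γ t a)
  ⊎ (∃ λ C → IsComponent Γ C × 0 < nonzeros (inside C t) × 0 < nonzeros (outside C t))
localize Γ t t≢0 with zeros-or-entry t
... | inj₁ t≡0 = ⊥-elim (t≢0 t≡0)
... | inj₂ (i , b , t[i]) with generatedComponent Γ b
...   | C , gen@(isC , b∈C , _) with zeros-or-entry (outside C t)
...     | inj₁ out≡0          = inj₁ (suc b , C , gen , outside-zeros⇒contained C t out≡0)
...     | inj₂ (j , _ , out[j]) =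
  inj₂ (C , isC , inside-positive C t i t[i] b∈C , entry⇒positive (outside C t) j out[j])

-- A union counterexample whose first tuple is split nontrivially by a component C is not the
-- lightest: the part of t₁ inside C lies in R, so splitUnion applies.
splitUnionAlong : IsCC0 Γ → (n , P) ∈ Γ → Disj t₁ t₂ → UnionFailure P t₁ t₂ → IsComponent Γ C →
  0 < nonzeros (inside C t₁) → 0 < nonzeros (outside C t₁) → Lighter Γ (nonzeros t₁ + nonzeros t₂)
splitUnionAlong {Γ = Γ} {t₁ = t₁} {t₂ = t₂} {C = C} cc0 R∈Γ dj uf isC +s +u =
  subst (λ k → Lighter Γ (k + nonzeros t₂)) (nonzeros-split C t₁)
    (splitUnion cc0 R∈Γ uf (split C t₁) (split-disj C t₁) (map-disj (pr C) refl dj)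
                (map-disj (prᶜ C) refl dj) (project isC R∈Γ (UnionFailure.first∈ uf)) +s +u)

reduceUnion : IsCC0 Γ → (n , P) ∈ Γ → Disj t₁ t₂ → UnionFailure P t₁ t₂ →
  Localized Γ ⊎ Lighter Γ (nonzeros t₁ + nonzeros t₂)
reduceUnion {Γ = Γ} {t₁ = t₁} {t₂ = t₂} cc0 R∈Γ dj uf
  with localize Γ t₁ (union-nonzero₂ (union-sym dj uf)) | localize Γ t₂ (union-nonzero₂ uf)
... | inj₂ (C , isC , +s , +u) | _ = inj₂ (splitUnionAlong cc0 R∈Γ dj uf isC +s +u)
... | inj₁ _ | inj₂ (C , isC , +s , +u) =
  inj₂ (subst (Lighter Γ) (+-comm (nonzeros t₂) (nonzeros t₁))
              (splitUnionAlong cc0 R∈Γ (disj-sym dj) (union-sym dj uf) isC +s +u))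
... | inj₁ (a₁ , t₁∈C₁) | inj₁ (a₂ , t₂∈C₂) =
  inj₁ (_ , t₁ , t₂ , inj₁ (unionCounterexample R∈Γ dj uf , a₁ , a₂ , t₁∈C₁ , t₂∈C₂))

projectDifference : IsComponent Γ C → (n , P) ∈ Γ → Disj t₁ t₂ → DifferenceFailure P t₁ t₂ →
  P (inside C t₁) ≡ false → DifferenceFailure P (inside C t₁) (inside C t₂)
projectDifference {C = C} {P = P} isC R∈Γ dj (∖-failure p₂ p₁₂ _) s∉R =
  ∖-failure (project isC R∈Γ p₂) (trans (cong P (sym (map-⊕ (pr C) refl dj))) (project isC R∈Γ p₁₂)) s∉R

reduceDifference : IsCC0 Γ → (n , P) ∈ Γ → Disj t₁ t₂ → DifferenceFailure P t₁ t₂ →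
  Localized Γ ⊎ Lighter Γ (nonzeros t₁ + nonzeros t₂)
reduceDifference {Γ = Γ} {P = P} {t₁ = t₁} {t₂ = t₂} cc0 R∈Γ dj df@(∖-failure _ _ p₁)
  with zeros-or-entry t₁
... | inj₁ t₁≡0 = ⊥-elim (differ (zeroValid cc0 R∈Γ) p₁ (cong P (sym t₁≡0)))
... | inj₂ (i , b , t₁[i]) with generatedComponent Γ b
...   | C , gen@(isC , b∈C , _) with P (inside C t₁) in Pₛ
...     | false = inj₁ (_ , inside C t₁ , inside C t₂ ,
                        inj₂ (differenceCounterexample R∈Γ (inside-disj C dj) (projectDifference isC R∈Γ dj df Pₛ) ,
                              suc b , (C , gen , inside-contained C t₁) , (C , gen , inside-contained C t₂)))
...     | true  = inj₂ (subst (λ k → Lighter Γ (k + nonzeros t₂)) (nonzeros-split C t₁)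
                      (splitDifference cc0 R∈Γ df (split C t₁) (split-disj C t₁) (map-disj (pr C) refl dj)
                                       (map-disj (prᶜ C) refl dj) Pₛ (inside-positive C t₁ i t₁[i] b∈C)))

reduce : IsCC0 Γ → (c : Counterexample Γ) → Localized Γ ⊎ Lighter Γ (weight c)
reduce cc0 ((_ , _) , R∈Γ , _ , _ , dj , inj₁ uf) = reduceUnion cc0 R∈Γ (toDisj dj) uf
reduce cc0 ((_ , _) , R∈Γ , _ , _ , dj , inj₂ df) = reduceDifference cc0 R∈Γ (toDisj dj) df

disjoint? : ∀ (t₁ t₂ : Vec (Dom d) n) → Dec (Disjoint t₁ t₂)
disjoint? t₁ t₂ = all? λ i → (lookup t₁ i ≟ᶠ zero) ⊎-dec (lookup t₂ i ≟ᶠ zero)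

failure? : ∀ (P : Vec (Dom d) n → Bool) t₁ t₂ → Dec (Failure P t₁ t₂)
failure? P t₁ t₂ =
  map′ (λ (p₁ , p₂ , p₁₂) → ∪-failure p₁ p₂ p₁₂) (λ (∪-failure p₁ p₂ p₁₂) → p₁ , p₂ , p₁₂)
       (P t₁ ≟ᵇ true ×-dec P t₂ ≟ᵇ true ×-dec P (t₁ ⊕ t₂) ≟ᵇ false)
  ⊎-dec
  map′ (λ (p₂ , p₁₂ , p₁) → ∖-failure p₂ p₁₂ p₁) (λ (∖-failure p₂ p₁₂ p₁) → p₂ , p₁₂ , p₁)
       (P t₂ ≟ᵇ true ×-dec P (t₁ ⊕ t₂) ≟ᵇ true ×-dec P t₁ ≟ᵇ false)

separable-or-violated : ∀ (R : Rel d) → WeaklySeparable R ⊎ Violation R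
separable-or-violated (n , P)
  with anyTuple? n (λ t₁ → anyTuple? n λ t₂ → disjoint? t₁ t₂ ×-dec failure? P t₁ t₂)
... | yes violation  = inj₂ violation
... | no  ¬violation = inj₁ λ t₁ t₂ dj →
  (λ p₁ p₂ → ¬-not λ p₁₂ → ¬violation (t₁ , t₂ , dj , inj₁ (∪-failure p₁ p₂ p₁₂))) ,
  (λ p₂ p₁₂ → ¬-not λ p₁ → ¬violation (t₁ , t₂ , dj , inj₂ (∖-failure p₂ p₁₂ p₁)))

someCounterexample : ¬ LangWeaklySeparable Γ → Counterexample Γ
someCounterexample {Γ = Γ} ¬separable with All.decide separable-or-violated Γ
... | inj₁ separable = ⊥-elim (¬separable separable)
... | inj₂ violated  = find violated

descent : ∀ {A B : Set} (μ : A → ℕ) → (∀ x → B ⊎ Σ A λ y → μ y < μ x) → A → B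
descent {B = B} μ step x = go x (<-wellFounded (μ x))
  where
  go : ∀ x → Acc _<_ (μ x) → B
  go x (acc lighter) with step x
  ... | inj₁ b          = b
  ... | inj₂ (y , μy<μx) = go y (lighter μy<μx)

lemma3p19 : ∀ {d} (Γ : Lang d) → IsCC0 Γ → ¬ LangWeaklySeparable Γ →
    ∃ λ (R : Rel d) → ∃ λ (t₁ : Vec (Dom d) (arity R)) → ∃ λ (t₂ : Vec (Dom d) (arity R)) →
      (UnionCounterexample Γ R t₁ t₂
        × (∃ λ a₁ → ∃ λ a₂ → InGeneratedComponent Γ t₁ a₁ × InGeneratedComponent Γ t₂ a₂))
      ⊎ (DifferenceCounterexample Γ R t₁ t₂
        × (∃ λ a₁ → InGeneratedComponent Γ t₁ a₁ × InGeneratedComponent Γ t₂ a₁))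
lemma3p19 Γ cc0 ¬separable = descent weight (reduce cc0) (someCounterexample ¬separable)
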